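{- There exists a class $\mathcal{J}$ (a formula with one free variable in the language $\{e,\vdash,\circ\}$) such that $\mathsf{Seq}\vdash\phi^{\mathcal J}$ for each axiom $\phi$ of $\mathsf{Seq}^*$. Furthermore, writing $x\preceq y$ for $\exists z\in\mathcal{J}\,[y=xz]$, (provably in $\mathsf{Seq}$) $\preceq$ is reflexive and transitive, $\forall y\in\mathcal{J}\,\forall x\preceq y\,[x\in\mathcal{J}]$, and $\forall w\,[e\vdash w\in\mathcal{J}]$.
   Context: Language $\{e,\ \vdash,\ \circ\}$: $e$ constant, $\vdash$ and $\circ$ binary function symbols ($x\vdash y$ is a term, not provability; $x\circ y$ also written $xy$). $\mathsf{Seq}$ has axioms: $\mathsf{Seq}_1$: $\forall x y\, [x\vdash y\neq e]$; $\mathsf{Seq}_2$: $\forall x_1x_2y_1y_2\,[x_1\vdash x_2=y_1\vdash y_2\rightarrow (x_1=y_1\wedge x_2=y_2)]$; $\mathsf{Seq}_3$: $\forall x\,[x\circ e=x]$; $\mathsf{Seq}_4$: $\forall xyz\,[x\circ(y\vdash z)=(x\circ y)\vdash z]$; $\mathsf{Seq}_5$: $\forall x\,[x=e\vee\exists yz\,[x=y\vdash z]]$. $\mathsf{Seq}^*$ is obtained from $\mathsf{Seq}$ by replacing $\mathsf{Seq}_3$ with $\forall x[xe=x\wedge ex=x]$ and $\mathsf{Seq}_5$ with $\forall xyzw[xy=zw\leftrightarrow\exists u[(z=xu\wedge uw=y)\vee(x=zu\wedge uy=w)]]$. For a class $K$ and formula $\phi$, the relativization $\phi^K$ is defined by: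 $\phi^K=\phi$ for atomic $\phi$, commuting with Boolean connectives, $(\forall x\phi)^K=\forall x[K(x)\rightarrow\phi^K]$ and $(\exists x\phi)^K=\exists x[K(x)\wedge\phi^K]$. $x\in K$ means $K(x)$; $\exists z\in K[\psi]$ means $\exists z[K(z)\wedge\psi]$, $\forall x\preceq y[\psi]$ means $\forall x[x\preceq y\rightarrow\psi]$. -}

module Defs where

open import Data.Nat using (ℕ; zero; suc; _<_)
open import Data.List using (List; []; _∷_; map)
open import Data.List.Membership.Propositional using (_∈_)
open import Data.Product using (_×_)

infixl 8 _∙_
infixl 7 _▹_
infix  6 _≐_
infixr 5 _∧_
infixr 4 _∨_
infixr 3 _⇒_ _⇔_

-- Terms: variables (de Bruijn), e, x ⊢ y (written x ▹ y), x ∘ y (written x ∙ y)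
data Term : Set where
  var : ℕ → Term
  ε   : Term
  _▹_ : Term → Term → Term
  _∙_ : Term → Term → Term

data Formula : Set where
  _≐_ : Term → Term → Formula
  ⊥'  : Formula
  _⇒_ : Formula → Formula → Formula
  _∧_ : Formula → Formula → Formula
  _∨_ : Formula → Formula → Formula
  ∀'  : Formula → Formula
  ∃'  : Formula → Formula

¬' : Formula → Formula
¬' φ = φ ⇒ ⊥'

_⇔_ : Formula → Formula → Formula
φ ⇔ ψ = (φ ⇒ ψ) ∧ (ψ ⇒ φ)

ext : (ℕ → ℕ) → ℕ → ℕ
ext ρ zero    = zero
ext ρ (suc n) = suc (ρ n)

renT : (ℕ → ℕ) → Term → Term
renT ρ (var n) = var (ρ n)
renT ρ ε       = ε
renT ρ (s ▹ t) = renT ρ s ▹ renT ρ t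
renT ρ (s ∙ t) = renT ρ s ∙ renT ρ t

ren : (ℕ → ℕ) → Formula → Formula
ren ρ (s ≐ t) = renT ρ s ≐ renT ρ t
ren ρ ⊥'      = ⊥'
ren ρ (φ ⇒ ψ) = ren ρ φ ⇒ ren ρ ψ
ren ρ (φ ∧ ψ) = ren ρ φ ∧ ren ρ ψ
ren ρ (φ ∨ ψ) = ren ρ φ ∨ ren ρ ψ
ren ρ (∀' φ)  = ∀' (ren (ext ρ) φ)
ren ρ (∃' φ)  = ∃' (ren (ext ρ) φ)

wkT : Term → Term
wkT = renT suc

wk : Formula → Formula
wk = ren suc

lift : (ℕ → Term) → ℕ → Term
lift σ zero    = var zero
lift σ (suc n) = wkT (σ n)

subT : (ℕ → Term) → Term → Term
subT σ (var n) = σ n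
subT σ ε       = ε
subT σ (s ▹ t) = subT σ s ▹ subT σ t
subT σ (s ∙ t) = subT σ s ∙ subT σ t

sub : (ℕ → Term) → Formula → Formula
sub σ (s ≐ t) = subT σ s ≐ subT σ t
sub σ ⊥'      = ⊥'
sub σ (φ ⇒ ψ) = sub σ φ ⇒ sub σ ψ
sub σ (φ ∧ ψ) = sub σ φ ∧ sub σ ψ
sub σ (φ ∨ ψ) = sub σ φ ∨ sub σ ψ
sub σ (∀' φ)  = ∀' (sub (lift σ) φ)
sub σ (∃' φ)  = ∃' (sub (lift σ) φ)

σ₀ : Term → ℕ → Term
σ₀ t zero    = t
σ₀ t (suc n) = var n

_[_]₀ : Formula → Term → Formula
φ [ t ]₀ = sub (σ₀ t) φ

data WfT (n : ℕ) : Term → Set where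
  var : ∀ {m} → m < n → WfT n (var m)
  ε   : WfT n ε
  _▹_ : ∀ {s t} → WfT n s → WfT n t → WfT n (s ▹ t)
  _∙_ : ∀ {s t} → WfT n s → WfT n t → WfT n (s ∙ t)

data Wf (n : ℕ) : Formula → Set where
  _≐_ : ∀ {s t} → WfT n s → WfT n t → Wf n (s ≐ t)
  ⊥'  : Wf n ⊥'
  _⇒_ : ∀ {φ ψ} → Wf n φ → Wf n ψ → Wf n (φ ⇒ ψ)
  _∧_ : ∀ {φ ψ} → Wf n φ → Wf n ψ → Wf n (φ ∧ ψ)
  _∨_ : ∀ {φ ψ} → Wf n φ → Wf n ψ → Wf n (φ ∨ ψ)
  ∀'  : ∀ {φ} → Wf (suc n) φ → Wf n (∀' φ)
  ∃'  : ∀ {φ} → Wf (suc n) φ → Wf n (∃' φ)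

Theory : Set₁
Theory = Formula → Set

data Deriv (T : Theory) (Γ : List Formula) : Formula → Set where
  axiom : ∀ {φ} → T φ → Deriv T Γ φ
  hyp   : ∀ {φ} → φ ∈ Γ → Deriv T Γ φ
  raa   : ∀ {φ} → Deriv T (¬' φ ∷ Γ) ⊥' → Deriv T Γ φ
  ⇒I    : ∀ {φ ψ} → Deriv T (φ ∷ Γ) ψ → Deriv T Γ (φ ⇒ ψ)
  ⇒E    : ∀ {φ ψ} → Deriv T Γ (φ ⇒ ψ) → Deriv T Γ φ → Deriv T Γ ψ
  ∧I    : ∀ {φ ψ} → Deriv T Γ φ → Deriv T Γ ψ → Deriv T Γ (φ ∧ ψ)
  ∧E₁   : ∀ {φ ψ} → Deriv T Γ (φ ∧ ψ) → Deriv T Γ φ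
  ∧E₂   : ∀ {φ ψ} → Deriv T Γ (φ ∧ ψ) → Deriv T Γ ψ
  ∨I₁   : ∀ {φ ψ} → Deriv T Γ φ → Deriv T Γ (φ ∨ ψ)
  ∨I₂   : ∀ {φ ψ} → Deriv T Γ ψ → Deriv T Γ (φ ∨ ψ)
  ∨E    : ∀ {φ ψ χ} → Deriv T Γ (φ ∨ ψ) → Deriv T (φ ∷ Γ) χ → Deriv T (ψ ∷ Γ) χ
          → Deriv T Γ χ
  ∀I    : ∀ {φ} → Deriv T (map wk Γ) φ → Deriv T Γ (∀' φ)
  ∀E    : ∀ {φ} (t : Term) → Deriv T Γ (∀' φ) → Deriv T Γ (φ [ t ]₀)
  ∃I    : ∀ {φ} (t : Term) → Deriv T Γ (φ [ t ]₀) → Deriv T Γ (∃' φ)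
  ∃E    : ∀ {φ ψ} → Deriv T Γ (∃' φ) → Deriv T (φ ∷ map wk Γ) (wk ψ) → Deriv T Γ ψ
  ≐refl : ∀ (t : Term) → Deriv T Γ (t ≐ t)
  ≐subst : ∀ {s t} φ → Deriv T Γ (s ≐ t) → Deriv T Γ (φ [ s ]₀) → Deriv T Γ (φ [ t ]₀)

_⊢_ : Theory → Formula → Set
T ⊢ φ = Deriv T [] φ

v0 v1 v2 v3 v4 : Term
v0 = var 0
v1 = var 1
v2 = var 2
v3 = var 3
v4 = var 4

Seq₁ Seq₂ Seq₃ Seq₄ Seq₅ Seq₃* Seq₅* : Formula
Seq₁ = ∀' (∀' (¬' (v1 ▹ v0 ≐ ε)))
Seq₂ = ∀' (∀' (∀' (∀' ((v3 ▹ v2 ≐ v1 ▹ v0) ⇒ ((v3 ≐ v1) ∧ (v2 ≐ v0))))))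
Seq₃ = ∀' (v0 ∙ ε ≐ v0)
Seq₄ = ∀' (∀' (∀' (v2 ∙ (v1 ▹ v0) ≐ (v2 ∙ v1) ▹ v0)))
Seq₅ = ∀' ((v0 ≐ ε) ∨ ∃' (∃' (v2 ≐ v1 ▹ v0)))
Seq₃* = ∀' ((v0 ∙ ε ≐ v0) ∧ (ε ∙ v0 ≐ v0))
-- ∀xyzw [xy = zw ↔ ∃u [(z = xu ∧ uw = y) ∨ (x = zu ∧ uy = w)]]
Seq₅* = ∀' (∀' (∀' (∀' ((v3 ∙ v2 ≐ v1 ∙ v0) ⇔
          ∃' (((v2 ≐ v4 ∙ v0) ∧ (v0 ∙ v1 ≐ v3)) ∨ ((v4 ≐ v2 ∙ v0) ∧ (v0 ∙ v3 ≐ v1)))))))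

data Seq : Theory where
  s1 : Seq Seq₁
  s2 : Seq Seq₂
  s3 : Seq Seq₃
  s4 : Seq Seq₄
  s5 : Seq Seq₅

data Seq* : Theory where
  s1 : Seq* Seq₁
  s2 : Seq* Seq₂
  s3 : Seq* Seq₃*
  s4 : Seq* Seq₄
  s5 : Seq* Seq₅*

-- A class K is a formula with (at most) the free variable 0; K(t) := K[t/0].
_⟨_⟩ : Formula → Term → Formula
K ⟨ t ⟩ = K [ t ]₀

rel : Formula → Formula → Formula
rel K (s ≐ t) = s ≐ t
rel K ⊥'      = ⊥'
rel K (φ ⇒ ψ) = rel K φ ⇒ rel K ψ
rel K (φ ∧ ψ) = rel K φ ∧ rel K ψ
rel K (φ ∨ ψ) = rel K φ ∨ rel K ψ
rel K (∀' φ)  = ∀' (K ⟨ v0 ⟩ ⇒ rel K φ)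
rel K (∃' φ)  = ∃' (K ⟨ v0 ⟩ ∧ rel K φ)

prec : Formula → Term → Term → Formula
prec K s t = ∃' (K ⟨ v0 ⟩ ∧ (wkT t ≐ wkT s ∙ v0))

PrecRefl : Formula → Formula
PrecRefl K = ∀' (prec K v0 v0)

PrecTrans : Formula → Formula
PrecTrans K = ∀' (∀' (∀' ((prec K v2 v1 ∧ prec K v1 v0) ⇒ prec K v2 v0)))

PrecDown : Formula → Formula
PrecDown K = ∀' (K ⟨ v0 ⟩ ⇒ ∀' (prec K v0 v1 ⇒ K ⟨ v0 ⟩))

ConsE : Formula → Formula
ConsE K = ∀' (K ⟨ ε ▹ v0 ⟩)

-- J(x) collects what Seq* demands of x as a right factor: x associates on the
-- right, (yz)x = y(zx); e is a left unit for it, ex = x; it is right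
-- cancellable, yx = zx → y = z; and every equation ax = bu whose right factor u
-- associates on the right splits as required by Seq₅*.  Seq has no induction,
-- so everything rests on one-step closure: J contains e, is closed under
-- x ↦ x ⊢ w (Seq₅ writes the right factor u as e or as u' ⊢ w', and Seq₂
-- strips the last ⊢ off both sides), is closed under ∘, and contains x whenever
-- it contains xy and y.  These closure properties give the three properties of
-- ⪯ and e ⊢ w ∈ J; relativized, Seq₃* is the left-unit law, and the two
-- directions of Seq₅* are the splitting property and associativity.
module Submission where

open import Defs
open import Data.Product using (Σ; _×_; _,_)
open import Data.List using (List; _∷_)
open import Data.List.Relation.Unary.Any using (here; there)
open import Data.List.Relation.Binary.Subset.Propositional using (_⊆_)
open import Data.List.Relation.Binary.Subset.Propositional.Properties using (map⁺; ∷⁺ʳ)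
open import Data.Nat using (ℕ; suc; _<?_)
open import Data.Maybe using (Maybe; just; from-just; zipWith)
open import Relation.Nullary.Decidable using (dec⇒maybe)
open import Relation.Binary.PropositionalEquality as ≡ using (_≡_; refl; cong₂; subst; subst₂)

weaken : ∀ {T Γ Δ φ} → Γ ⊆ Δ → Deriv T Γ φ → Deriv T Δ φ
weaken Γ⊆Δ (axiom a)         = axiom a
weaken Γ⊆Δ (hyp p)           = hyp (Γ⊆Δ p)
weaken Γ⊆Δ (raa d)           = raa (weaken (∷⁺ʳ _ Γ⊆Δ) d)
weaken Γ⊆Δ (⇒I d)            = ⇒I (weaken (∷⁺ʳ _ Γ⊆Δ) d)
weaken Γ⊆Δ (⇒E d e)          = ⇒E (weaken Γ⊆Δ d) (weaken Γ⊆Δ e)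
weaken Γ⊆Δ (∧I d e)          = ∧I (weaken Γ⊆Δ d) (weaken Γ⊆Δ e)
weaken Γ⊆Δ (∧E₁ d)           = ∧E₁ (weaken Γ⊆Δ d)
weaken Γ⊆Δ (∧E₂ d)           = ∧E₂ (weaken Γ⊆Δ d)
weaken Γ⊆Δ (∨I₁ d)           = ∨I₁ (weaken Γ⊆Δ d)
weaken Γ⊆Δ (∨I₂ d)           = ∨I₂ (weaken Γ⊆Δ d)
weaken Γ⊆Δ (∨E d e f)        = ∨E (weaken Γ⊆Δ d) (weaken (∷⁺ʳ _ Γ⊆Δ) e) (weaken (∷⁺ʳ _ Γ⊆Δ) f)
weaken Γ⊆Δ (∀I d)            = ∀I (weaken (map⁺ wk Γ⊆Δ) d)
weaken Γ⊆Δ (∀E t d)          = ∀E t (weaken Γ⊆Δ d)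
weaken Γ⊆Δ (∃I t d)          = ∃I t (weaken Γ⊆Δ d)
weaken Γ⊆Δ (∃E d e)          = ∃E (weaken Γ⊆Δ d) (weaken (∷⁺ʳ _ (map⁺ wk Γ⊆Δ)) e)
weaken Γ⊆Δ (≐refl t)         = ≐refl t
weaken Γ⊆Δ (≐subst φ d e)    = ≐subst φ (weaken Γ⊆Δ d) (weaken Γ⊆Δ e)

wkT² wkT³ wkT⁴ : Term → Term
wkT² t = wkT (wkT t)
wkT³ t = wkT (wkT² t)
wkT⁴ t = wkT (wkT³ t)

subT-σ₀-wkT : ∀ s t → subT (σ₀ s) (wkT t) ≡ t
subT-σ₀-wkT s (var n) = refl
subT-σ₀-wkT s ε       = refl
subT-σ₀-wkT s (a ▹ b) = cong₂ _▹_ (subT-σ₀-wkT s a) (subT-σ₀-wkT s b)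
subT-σ₀-wkT s (a ∙ b) = cong₂ _∙_ (subT-σ₀-wkT s a) (subT-σ₀-wkT s b)

subT-lift-wkT : ∀ σ t → subT (lift σ) (wkT t) ≡ wkT (subT σ t)
subT-lift-wkT σ (var n) = refl
subT-lift-wkT σ ε       = refl
subT-lift-wkT σ (a ▹ b) = cong₂ _▹_ (subT-lift-wkT σ a) (subT-lift-wkT σ b)
subT-lift-wkT σ (a ∙ b) = cong₂ _∙_ (subT-lift-wkT σ a) (subT-lift-wkT σ b)

subT-σ₀-wkT² : ∀ a b c → subT (σ₀ c) (subT (lift (σ₀ b)) (wkT² a)) ≡ a
subT-σ₀-wkT² a b c = begin
  subT (σ₀ c) (subT (lift (σ₀ b)) (wkT² a))  ≡⟨ ≡.cong (subT (σ₀ c)) (subT-lift-wkT (σ₀ b) (wkT a)) ⟩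
  subT (σ₀ c) (wkT (subT (σ₀ b) (wkT a)))    ≡⟨ subT-σ₀-wkT c _ ⟩
  subT (σ₀ b) (wkT a)                        ≡⟨ subT-σ₀-wkT b a ⟩
  a                                          ∎
  where open ≡.≡-Reasoning

subT-σ₀-wkT³ : ∀ a b c d →
  subT (σ₀ d) (subT (lift (σ₀ c)) (subT (lift (lift (σ₀ b))) (wkT³ a))) ≡ a
subT-σ₀-wkT³ a b c d = begin
  subT (σ₀ d) (subT (lift (σ₀ c)) (subT (lift (lift (σ₀ b))) (wkT³ a)))
    ≡⟨ ≡.cong (λ u → subT (σ₀ d) (subT (lift (σ₀ c)) u)) (subT-lift-wkT (lift (σ₀ b)) (wkT² a)) ⟩
  subT (σ₀ d) (subT (lift (σ₀ c)) (wkT (subT (lift (σ₀ b)) (wkT² a))))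
    ≡⟨ ≡.cong (subT (σ₀ d)) (subT-lift-wkT (σ₀ c) (subT (lift (σ₀ b)) (wkT² a))) ⟩
  subT (σ₀ d) (wkT (subT (σ₀ c) (subT (lift (σ₀ b)) (wkT² a))))
    ≡⟨ subT-σ₀-wkT d _ ⟩
  subT (σ₀ c) (subT (lift (σ₀ b)) (wkT² a))
    ≡⟨ subT-σ₀-wkT² a b c ⟩
  a ∎
  where open ≡.≡-Reasoning

module _ {T : Theory} {Γ : List Formula} where

  ≐sym : ∀ {s t} → Deriv T Γ (s ≐ t) → Deriv T Γ (t ≐ s)
  ≐sym {s} {t} s≐t = subst (λ u → Deriv T Γ (t ≐ u)) (subT-σ₀-wkT t s)
    (≐subst (v0 ≐ wkT s) s≐t (subst (λ u → Deriv T Γ (s ≐ u)) (≡.sym (subT-σ₀-wkT s s)) (≐refl s)))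

  ≐trans : ∀ {s t r} → Deriv T Γ (s ≐ t) → Deriv T Γ (t ≐ r) → Deriv T Γ (s ≐ r)
  ≐trans {s} {t} {r} s≐t t≐r = subst (λ u → Deriv T Γ (u ≐ r)) (subT-σ₀-wkT r s)
    (≐subst (wkT s ≐ v0) t≐r (subst (λ u → Deriv T Γ (u ≐ t)) (≡.sym (subT-σ₀-wkT t s)) s≐t))

  ≐cong : ∀ {s t} (C : Term) → Deriv T Γ (s ≐ t) → Deriv T Γ (subT (σ₀ s) C ≐ subT (σ₀ t) C)
  ≐cong {s} {t} C s≐t = subst (λ u → Deriv T Γ (u ≐ subT (σ₀ t) C)) (subT-σ₀-wkT t _)
    (≐subst (wkT (subT (σ₀ s) C) ≐ C) s≐t
      (subst (λ u → Deriv T Γ (u ≐ subT (σ₀ s) C)) (≡.sym (subT-σ₀-wkT s _)) (≐refl _)))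

  ∙-congˡ : ∀ {t t'} s → Deriv T Γ (t ≐ t') → Deriv T Γ (s ∙ t ≐ s ∙ t')
  ∙-congˡ {t} {t'} s t≐t' = subst₂ (λ a b → Deriv T Γ (a ∙ t ≐ b ∙ t'))
    (subT-σ₀-wkT t s) (subT-σ₀-wkT t' s) (≐cong (wkT s ∙ v0) t≐t')

  ∙-congʳ : ∀ {s s'} t → Deriv T Γ (s ≐ s') → Deriv T Γ (s ∙ t ≐ s' ∙ t)
  ∙-congʳ {s} {s'} t s≐s' = subst₂ (λ a b → Deriv T Γ (s ∙ a ≐ s' ∙ b))
    (subT-σ₀-wkT s t) (subT-σ₀-wkT s' t) (≐cong (v0 ∙ wkT t) s≐s')

  ▹-congˡ : ∀ {t t'} s → Deriv T Γ (t ≐ t') → Deriv T Γ (s ▹ t ≐ s ▹ t')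
  ▹-congˡ {t} {t'} s t≐t' = subst₂ (λ a b → Deriv T Γ (a ▹ t ≐ b ▹ t'))
    (subT-σ₀-wkT t s) (subT-σ₀-wkT t' s) (≐cong (wkT s ▹ v0) t≐t')

  ▹-congʳ : ∀ {s s'} t → Deriv T Γ (s ≐ s') → Deriv T Γ (s ▹ t ≐ s' ▹ t)
  ▹-congʳ {s} {s'} t s≐s' = subst₂ (λ a b → Deriv T Γ (s ▹ a ≐ s' ▹ b))
    (subT-σ₀-wkT s t) (subT-σ₀-wkT s' t) (≐cong (v0 ▹ wkT t) s≐s')

  infixr 2 _≐⟨_⟩_
  infix  3 _∎

  _≐⟨_⟩_ : ∀ x {y z} → Deriv T Γ (x ≐ y) → Deriv T Γ (y ≐ z) → Deriv T Γ (x ≐ z)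
  x ≐⟨ x≐y ⟩ y≐z = ≐trans x≐y y≐z

  _∎ : ∀ x → Deriv T Γ (x ≐ x)
  x ∎ = ≐refl x

infix 1 _⊩_
_⊩_ : List Formula → Formula → Set
Γ ⊩ φ = Deriv Seq Γ φ

closed : ∀ {Γ φ} → Seq ⊢ φ → Γ ⊩ φ
closed = weaken (λ ())

cut : ∀ {Γ φ ψ} → Γ ⊩ φ → φ ∷ Γ ⊩ ψ → Γ ⊩ ψ
cut d e = ⇒E (⇒I e) d

#0 : ∀ {Γ φ} → φ ∷ Γ ⊩ φ
#0 = hyp (here refl)
#1 : ∀ {Γ φ a} → a ∷ φ ∷ Γ ⊩ φ
#1 = hyp (there (here refl))
#2 : ∀ {Γ φ a b} → b ∷ a ∷ φ ∷ Γ ⊩ φ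
#2 = hyp (there (there (here refl)))
#3 : ∀ {Γ φ a b c} → c ∷ b ∷ a ∷ φ ∷ Γ ⊩ φ
#3 = hyp (there (there (there (here refl))))
#4 : ∀ {Γ φ a b c d} → d ∷ c ∷ b ∷ a ∷ φ ∷ Γ ⊩ φ
#4 = hyp (there (there (there (there (here refl)))))
#5 : ∀ {Γ φ a b c d e} → e ∷ d ∷ c ∷ b ∷ a ∷ φ ∷ Γ ⊩ φ
#5 = hyp (there (there (there (there (there (here refl))))))
#6 : ∀ {Γ φ a b c d e f} → f ∷ e ∷ d ∷ c ∷ b ∷ a ∷ φ ∷ Γ ⊩ φ
#6 = hyp (there (there (there (there (there (there (here refl)))))))
#7 : ∀ {Γ φ a b c d e f g} → g ∷ f ∷ e ∷ d ∷ c ∷ b ∷ a ∷ φ ∷ Γ ⊩ φ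
#7 = hyp (there (there (there (there (there (there (there (here refl))))))))
#9 : ∀ {Γ φ a b c d e f g h i} → i ∷ h ∷ g ∷ f ∷ e ∷ d ∷ c ∷ b ∷ a ∷ φ ∷ Γ ⊩ φ
#9 = hyp (there (there (there (there (there (there (there (there (there (here refl))))))))))

▹≉ε : ∀ {Γ a b} → Γ ⊩ a ▹ b ≐ ε → Γ ⊩ ⊥'
▹≉ε {Γ} {a} {b} = ⇒E (subst (λ X → Γ ⊩ ¬' (X ▹ b ≐ ε)) (subT-σ₀-wkT b a) (∀E b (∀E a (axiom s1))))

▹-injective : ∀ {Γ a b c d} → Γ ⊩ a ▹ b ≐ c ▹ d → Γ ⊩ (a ≐ c) ∧ (b ≐ d)
▹-injective {Γ} {a} {b} {c} {d} = ⇒E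
  (subst (λ Z → Γ ⊩ (a ▹ b ≐ Z ▹ d) ⇒ ((a ≐ Z) ∧ (b ≐ d))) (subT-σ₀-wkT d c)
    (subst₂ (λ X Y → Γ ⊩ (X ▹ Y ≐ _ ▹ d) ⇒ ((X ≐ _) ∧ (Y ≐ d))) (subT-σ₀-wkT³ a b c d) (subT-σ₀-wkT² b c d)
      (∀E d (∀E c (∀E b (∀E a (axiom s2)))))))

∙-identityʳ : ∀ {Γ} t → Γ ⊩ t ∙ ε ≐ t
∙-identityʳ t = ∀E t (axiom s3)

∙-assoc-▹ : ∀ {Γ} x y z → Γ ⊩ x ∙ (y ▹ z) ≐ (x ∙ y) ▹ z
∙-assoc-▹ {Γ} x y z = subst₂ (λ X Y → Γ ⊩ X ∙ (Y ▹ z) ≐ (X ∙ Y) ▹ z) (subT-σ₀-wkT² x y z) (subT-σ₀-wkT z y)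
  (∀E z (∀E y (∀E x (axiom s4))))

ε-or-▹ : ∀ {Γ} t → Γ ⊩ (t ≐ ε) ∨ ∃' (∃' (wkT² t ≐ v1 ▹ v0))
ε-or-▹ t = ∀E t (axiom s5)

v5 v6 v7 : Term
v5 = var 5
v6 = var 6
v7 = var 7

-- Equidivisible y reads: ∀u. RightAssoc u → ∀a b. a y = b u →
--   ∃v. RightAssoc v ∧ ((b = a v ∧ v u = y) ∨ (a = b v ∧ v y = u)).
RightAssoc LeftUnit RightCancel Equidivisible InJ : Term → Formula
RightAssoc z = ∀' (∀' ((v1 ∙ v0) ∙ wkT² z ≐ v1 ∙ (v0 ∙ wkT² z)))
LeftUnit z = ε ∙ z ≐ z
RightCancel z = ∀' (∀' ((v1 ∙ wkT² z ≐ v0 ∙ wkT² z) ⇒ (v1 ≐ v0)))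
Equidivisible y = ∀' (RightAssoc v0 ⇒ ∀' (∀' ((v1 ∙ wkT³ y ≐ v0 ∙ v2) ⇒
  ∃' (RightAssoc v0 ∧ (((v1 ≐ v2 ∙ v0) ∧ (v0 ∙ v3 ≐ wkT⁴ y)) ∨ ((v2 ≐ v1 ∙ v0) ∧ (v0 ∙ wkT⁴ y ≐ v3)))))))
InJ t = RightAssoc t ∧ LeftUnit t ∧ RightCancel t ∧ Equidivisible t

J : Formula
J = InJ v0

-- Closure properties are proved as universally quantified Seq-theorems and
-- instantiated with ∀E, which needs no substitution lemma for formulas.
RightAssoc-ε : Seq ⊢ RightAssoc ε
RightAssoc-ε = ∀I (∀I (≐trans (∙-identityʳ (v1 ∙ v0)) (∙-congˡ v1 (≐sym (∙-identityʳ v0)))))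

RightCancel-ε : Seq ⊢ RightCancel ε
RightCancel-ε = ∀I (∀I (⇒I (≐trans (≐sym (∙-identityʳ v1)) (≐trans #0 (∙-identityʳ v0)))))

Equidivisible-ε : Seq ⊢ Equidivisible ε
Equidivisible-ε = ∀I (⇒I (∀I (∀I (⇒I (∃I v2 (∧I #1 (∨I₂ (∧I (≐trans (≐sym (∙-identityʳ v1)) #0) (∙-identityʳ v2)))))))))

InJ-ε : Seq ⊢ InJ ε
InJ-ε = ∧I RightAssoc-ε (∧I (∙-identityʳ ε) (∧I RightCancel-ε Equidivisible-ε))

RightAssoc-▹ : Seq ⊢ ∀' (∀' (RightAssoc v1 ⇒ RightAssoc (v1 ▹ v0)))
RightAssoc-▹ = ∀I (∀I (⇒I (∀I (∀I (
  (v1 ∙ v0) ∙ (v3 ▹ v2) ≐⟨ ∙-assoc-▹ (v1 ∙ v0) v3 v2 ⟩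
  ((v1 ∙ v0) ∙ v3) ▹ v2 ≐⟨ ▹-congʳ v2 (∀E v0 (∀E v1 #0)) ⟩
  (v1 ∙ (v0 ∙ v3)) ▹ v2 ≐⟨ ≐sym (∙-assoc-▹ v1 (v0 ∙ v3) v2) ⟩
  v1 ∙ ((v0 ∙ v3) ▹ v2) ≐⟨ ∙-congˡ v1 (≐sym (∙-assoc-▹ v0 v3 v2)) ⟩
  v1 ∙ (v0 ∙ (v3 ▹ v2)) ∎)))))

LeftUnit-▹ : Seq ⊢ ∀' (∀' (LeftUnit v1 ⇒ LeftUnit (v1 ▹ v0)))
LeftUnit-▹ = ∀I (∀I (⇒I (≐trans (∙-assoc-▹ ε v1 v0) (▹-congʳ v0 #0))))

RightCancel-▹ : Seq ⊢ ∀' (∀' (RightCancel v1 ⇒ RightCancel (v1 ▹ v0)))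
RightCancel-▹ = ∀I (∀I (⇒I (∀I (∀I (⇒I (⇒E (∀E v0 (∀E v1 #1))
  (∧E₁ (▹-injective (≐trans (≐sym (∙-assoc-▹ v1 v3 v2)) (≐trans #0 (∙-assoc-▹ v0 v3 v2)))))))))))

RightAssoc-▹⁻ : Seq ⊢ ∀' (∀' (RightAssoc (v1 ▹ v0) ⇒ RightAssoc v1))
RightAssoc-▹⁻ = ∀I (∀I (⇒I (∀I (∀I (∧E₁ (▹-injective
  (≐trans (≐sym (∙-assoc-▹ (v1 ∙ v0) v3 v2)) (≐trans (∀E v0 (∀E v1 #0))
    (≐trans (∙-congˡ v1 (∙-assoc-▹ v0 v3 v2)) (∙-assoc-▹ v1 (v0 ∙ v3) v2))))))))))

-- By Seq₅, u is e (take v = y ⊢ w) or u' ⊢ w'; then Seq₂ reduces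
-- a (y ⊢ w) = b (u' ⊢ w') to a y = b u' and w = w', and splitting a y = b u'
-- at y splits the original equation.
Equidivisible-▹ : Seq ⊢ ∀' (∀' (RightAssoc v1 ⇒ Equidivisible v1 ⇒ Equidivisible (v1 ▹ v0)))
Equidivisible-▹ = ∀I (∀I (⇒I (⇒I (∀I (⇒I (∀I (∀I (⇒I (∨E (ε-or-▹ v2)
  (∃I (v4 ▹ v3) (∧I (⇒E (∀E v3 (∀E v4 (closed RightAssoc-▹))) #4)
     (∨I₁ (∧I (≐trans (≐sym (∙-identityʳ v0)) (≐trans (∙-congˡ v0 (≐sym #0)) (≐sym #1)))
              (≐trans (∙-congˡ (v4 ▹ v3) #0) (∙-identityʳ (v4 ▹ v3)))))))
  (∃E #0 (∃E #0
    (let ay≐bu′×w≐w′ = ▹-injective (≐trans (≐sym (∙-assoc-▹ v3 v6 v5))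
                                     (≐trans #3 (≐trans (∙-congˡ v2 #0) (∙-assoc-▹ v2 v1 v0))))
    in cut (∧E₂ ay≐bu′×w≐w′)
      (∃E (⇒E (∀E v2 (∀E v3 (⇒E (∀E v1 #6)
                (⇒E (∀E v0 (∀E v1 (closed RightAssoc-▹⁻))) (≐subst (RightAssoc v0) #1 #5)))))
              (weaken there (∧E₁ ay≐bu′×w≐w′)))
        (∃I v0 (∧I (∧E₁ #0) (∨E (∧E₂ #0)
          (∨I₁ (∧I (∧E₁ #0) (≐trans (∙-congˡ v0 #3)
            (≐trans (∙-assoc-▹ v0 v2 v1) (≐trans (▹-congʳ v1 (∧E₂ #0)) (▹-congˡ v7 (≐sym #2)))))))
          (∨I₂ (∧I (∧E₁ #0) (≐trans (∙-assoc-▹ v0 v7 v6)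
            (≐trans (▹-congʳ v6 (∧E₂ #0)) (≐trans (▹-congˡ v2 #2) (≐sym #3))))))))))))))))))))))

InJ-▹ : Seq ⊢ ∀' (∀' (InJ v1 ⇒ InJ (v1 ▹ v0)))
InJ-▹ = ∀I (∀I (⇒I (∧I (⇒E (∀E v0 (∀E v1 (closed RightAssoc-▹))) (∧E₁ #0))
  (∧I (⇒E (∀E v0 (∀E v1 (closed LeftUnit-▹))) (∧E₁ (∧E₂ #0)))
  (∧I (⇒E (∀E v0 (∀E v1 (closed RightCancel-▹))) (∧E₁ (∧E₂ (∧E₂ #0))))
      (⇒E (⇒E (∀E v0 (∀E v1 (closed Equidivisible-▹))) (∧E₁ #0)) (∧E₂ (∧E₂ (∧E₂ #0)))))))))

RightAssoc-∙ : Seq ⊢ ∀' (∀' (RightAssoc v1 ⇒ RightAssoc v0 ⇒ RightAssoc (v1 ∙ v0)))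
RightAssoc-∙ = ∀I (∀I (⇒I (⇒I (∀I (∀I (
  (v1 ∙ v0) ∙ (v3 ∙ v2) ≐⟨ ≐sym (∀E v3 (∀E (v1 ∙ v0) #0)) ⟩
  ((v1 ∙ v0) ∙ v3) ∙ v2 ≐⟨ ∙-congʳ v2 (∀E v0 (∀E v1 #1)) ⟩
  (v1 ∙ (v0 ∙ v3)) ∙ v2 ≐⟨ ∀E (v0 ∙ v3) (∀E v1 #0) ⟩
  v1 ∙ ((v0 ∙ v3) ∙ v2) ≐⟨ ∙-congˡ v1 (∀E v3 (∀E v0 #0)) ⟩
  v1 ∙ (v0 ∙ (v3 ∙ v2)) ∎))))))

LeftUnit-∙ : Seq ⊢ ∀' (∀' (RightAssoc v0 ⇒ LeftUnit v1 ⇒ LeftUnit v0 ⇒ LeftUnit (v1 ∙ v0)))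
LeftUnit-∙ = ∀I (∀I (⇒I (⇒I (⇒I (≐trans (≐sym (∀E v1 (∀E ε #2))) (∙-congʳ v0 #1))))))

RightCancel-∙ : Seq ⊢ ∀' (∀' (RightAssoc v0 ⇒ RightCancel v1 ⇒ RightCancel v0 ⇒ RightCancel (v1 ∙ v0)))
RightCancel-∙ = ∀I (∀I (⇒I (⇒I (⇒I (∀I (∀I (⇒I (
  ⇒E (∀E v0 (∀E v1 #2)) (⇒E (∀E (v0 ∙ v3) (∀E (v1 ∙ v3) #1))
    (≐trans (∀E v3 (∀E v1 #3)) (≐trans #0 (≐sym (∀E v3 (∀E v0 #3))))))))))))))

-- Split (a x) y = b u at y; in the case a x = b v, v y = u split a x = b v at x.
Equidivisible-∙ : Seq ⊢ ∀' (∀' (RightAssoc v1 ⇒ RightAssoc v0 ⇒ Equidivisible v1 ⇒ Equidivisible v0 ⇒ Equidivisible (v1 ∙ v0)))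
Equidivisible-∙ = ∀I (∀I (⇒I (⇒I (⇒I (⇒I (∀I (⇒I (∀I (∀I (⇒I (
  ∃E (⇒E (∀E v0 (∀E (v1 ∙ v4) (⇒E (∀E v2 #2) #1))) (≐trans (∀E v4 (∀E v1 #4)) #0))
    (∨E (∧E₂ #0)
      (∃I (v5 ∙ v0) (∧I (⇒E (⇒E (∀E v0 (∀E v5 (closed RightAssoc-∙))) #7) (∧E₁ #1))
        (∨I₁ (∧I (≐trans (∧E₁ #0) (∀E v5 (∀E v2 (∧E₁ #1))))
                 (≐trans (∀E v0 (∀E v5 #3)) (∙-congˡ v5 (∧E₂ #0)))))))
      (cut (∧E₂ #0) (∃E (⇒E (∀E v1 (∀E v2 (⇒E (∀E v0 #6) (∧E₁ #2)))) (∧E₁ #1))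
        (∃I v0 (∧I (∧E₁ #0) (∨E (∧E₂ #0)
          (∨I₁ (∧I (∧E₁ #0) (≐trans (∙-congˡ v0 (≐sym #2)) (≐trans (≐sym (∀E v1 (∀E v0 #9))) (∙-congʳ v5 (∧E₂ #0))))))
          (∨I₂ (∧I (∧E₁ #0) (≐trans (≐sym (∀E v6 (∀E v0 #9))) (≐trans (∙-congʳ v5 (∧E₂ #0)) #2)))))))))))))))))))))

InJ-∙ : Seq ⊢ ∀' (∀' (InJ v1 ⇒ InJ v0 ⇒ InJ (v1 ∙ v0)))
InJ-∙ = ∀I (∀I (⇒I (⇒I (∧I (⇒E (⇒E (∀E v0 (∀E v1 (closed RightAssoc-∙))) (∧E₁ #1)) (∧E₁ #0))
  (∧I (⇒E (⇒E (⇒E (∀E v0 (∀E v1 (closed LeftUnit-∙))) (∧E₁ #0)) (∧E₁ (∧E₂ #1))) (∧E₁ (∧E₂ #0)))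
  (∧I (⇒E (⇒E (⇒E (∀E v0 (∀E v1 (closed RightCancel-∙))) (∧E₁ #0)) (∧E₁ (∧E₂ (∧E₂ #1)))) (∧E₁ (∧E₂ (∧E₂ #0))))
      (⇒E (⇒E (⇒E (⇒E (∀E v0 (∀E v1 (closed Equidivisible-∙))) (∧E₁ #1)) (∧E₁ #0)) (∧E₂ (∧E₂ (∧E₂ #1)))) (∧E₂ (∧E₂ (∧E₂ #0))))))))))

RightAssoc-prefix : Seq ⊢ ∀' (∀' (RightAssoc (v1 ∙ v0) ⇒ RightAssoc v0 ⇒ RightCancel v0 ⇒ RightAssoc v1))
RightAssoc-prefix = ∀I (∀I (⇒I (⇒I (⇒I (∀I (∀I (⇒E (∀E (v1 ∙ (v0 ∙ v3)) (∀E ((v1 ∙ v0) ∙ v3) #0))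
  (((v1 ∙ v0) ∙ v3) ∙ v2 ≐⟨ ∀E v3 (∀E (v1 ∙ v0) #1) ⟩
   (v1 ∙ v0) ∙ (v3 ∙ v2) ≐⟨ ∀E v0 (∀E v1 #2) ⟩
   v1 ∙ (v0 ∙ (v3 ∙ v2)) ≐⟨ ∙-congˡ v1 (≐sym (∀E v3 (∀E v0 #1))) ⟩
   v1 ∙ ((v0 ∙ v3) ∙ v2) ≐⟨ ≐sym (∀E (v0 ∙ v3) (∀E v1 #1)) ⟩
   (v1 ∙ (v0 ∙ v3)) ∙ v2 ∎))))))))

LeftUnit-prefix : Seq ⊢ ∀' (∀' (LeftUnit (v1 ∙ v0) ⇒ RightAssoc v0 ⇒ RightCancel v0 ⇒ LeftUnit v1))
LeftUnit-prefix = ∀I (∀I (⇒I (⇒I (⇒I (⇒E (∀E v1 (∀E (ε ∙ v1) #0)) (≐trans (∀E v1 (∀E ε #1)) #2))))))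

RightCancel-prefix : Seq ⊢ ∀' (∀' (RightCancel (v1 ∙ v0) ⇒ RightAssoc v0 ⇒ RightCancel v1))
RightCancel-prefix = ∀I (∀I (⇒I (⇒I (∀I (∀I (⇒I (⇒E (∀E v0 (∀E v1 #2))
  (≐trans (≐sym (∀E v3 (∀E v1 #1))) (≐trans (∙-congʳ v2 #0) (∀E v3 (∀E v0 #1)))))))))))

-- Split a (x y) = b (u y) at x y, then cancel y on the right.
Equidivisible-prefix : Seq ⊢ ∀' (∀' (Equidivisible (v1 ∙ v0) ⇒ RightAssoc v0 ⇒ RightCancel v0 ⇒ Equidivisible v1))
Equidivisible-prefix = ∀I (∀I (⇒I (⇒I (⇒I (∀I (⇒I (∀I (∀I (⇒I (
  ∃E (⇒E (∀E v0 (∀E v1 (⇒E (∀E (v2 ∙ v3) #4) (⇒E (⇒E (∀E v3 (∀E v2 (closed RightAssoc-∙))) #1) #3))))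
         (≐trans (≐sym (∀E v4 (∀E v1 #3))) (≐trans (∙-congʳ v3 #0) (∀E v2 (∀E v0 #3)))))
    (∃I v0 (∧I (∧E₁ #0) (∨E (∧E₂ #0)
      (∨I₁ (∧I (∧E₁ #0) (⇒E (∀E v5 (∀E (v0 ∙ v3) #4)) (≐trans (∀E v3 (∀E v0 #5)) (∧E₂ #0)))))
      (∨I₂ (∧I (∧E₁ #0) (⇒E (∀E v3 (∀E (v0 ∙ v5) #4)) (≐trans (∀E v5 (∀E v0 #5)) (∧E₂ #0))))))))))))))))))

InJ-prefix : Seq ⊢ ∀' (∀' (InJ (v1 ∙ v0) ⇒ InJ v0 ⇒ InJ v1))
InJ-prefix = ∀I (∀I (⇒I (⇒I (∧I (⇒E (⇒E (⇒E (∀E v0 (∀E v1 (closed RightAssoc-prefix))) (∧E₁ #1)) (∧E₁ #0)) (∧E₁ (∧E₂ (∧E₂ #0))))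
  (∧I (⇒E (⇒E (⇒E (∀E v0 (∀E v1 (closed LeftUnit-prefix))) (∧E₁ (∧E₂ #1))) (∧E₁ #0)) (∧E₁ (∧E₂ (∧E₂ #0))))
  (∧I (⇒E (⇒E (∀E v0 (∀E v1 (closed RightCancel-prefix))) (∧E₁ (∧E₂ (∧E₂ #1)))) (∧E₁ #0))
      (⇒E (⇒E (⇒E (∀E v0 (∀E v1 (closed Equidivisible-prefix))) (∧E₂ (∧E₂ (∧E₂ #1)))) (∧E₁ #0)) (∧E₁ (∧E₂ (∧E₂ #0))))))))))

checkWfT : (n : ℕ) (t : Term) → Maybe (WfT n t)
checkWfT n (var m) = Data.Maybe.map var (dec⇒maybe (m <? n))
checkWfT n ε       = just ε
checkWfT n (a ▹ b) = zipWith _▹_ (checkWfT n a) (checkWfT n b)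
checkWfT n (a ∙ b) = zipWith _∙_ (checkWfT n a) (checkWfT n b)

checkWf : (n : ℕ) (φ : Formula) → Maybe (Wf n φ)
checkWf n (a ≐ b) = zipWith _≐_ (checkWfT n a) (checkWfT n b)
checkWf n ⊥'      = just ⊥'
checkWf n (φ ⇒ ψ) = zipWith _⇒_ (checkWf n φ) (checkWf n ψ)
checkWf n (φ ∧ ψ) = zipWith _∧_ (checkWf n φ) (checkWf n ψ)
checkWf n (φ ∨ ψ) = zipWith _∨_ (checkWf n φ) (checkWf n ψ)
checkWf n (∀' φ)  = Data.Maybe.map ∀' (checkWf (suc n) φ)
checkWf n (∃' φ)  = Data.Maybe.map ∃' (checkWf (suc n) φ)

Wf-J : Wf 1 J
Wf-J = from-just (checkWf 1 J)

-- Forward: split x y = z w at y; the witness v is in J because v w = y or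
-- v y = w.  Backward: associativity of the right factor.
Seq₅*ᴶ : Seq ⊢ rel J Seq₅*
Seq₅*ᴶ = ∀I (⇒I (∀I (⇒I (∀I (⇒I (∀I (⇒I (∧I
  (⇒I (∃E (⇒E (∀E v1 (∀E v3 (⇒E (∀E v0 (∧E₂ (∧E₂ (∧E₂ #3)))) (∧E₁ #1)))) #0)
    (∃I v0 (∨E (∧E₂ #0)
      (∧I (⇒E (⇒E (∀E v1 (∀E v0 (closed InJ-prefix))) (≐subst (InJ v0) (≐sym (∧E₂ #0)) #5)) #3) (∨I₁ #0))
      (∧I (⇒E (⇒E (∀E v3 (∀E v0 (closed InJ-prefix))) (≐subst (InJ v0) (≐sym (∧E₂ #0)) #3)) #5) (∨I₂ #0))))))
  (⇒I (∃E #0 (∨E (∧E₂ #0)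
    (≐trans (∙-congˡ v4 (≐sym (∧E₂ #0))) (≐trans (≐sym (∀E v0 (∀E v4 (∧E₁ #3)))) (∙-congʳ v1 (≐sym (∧E₁ #0)))))
    (≐sym (≐trans (∙-congˡ v2 (≐sym (∧E₂ #0))) (≐trans (≐sym (∀E v0 (∀E v2 (∧E₁ #5)))) (∙-congʳ v3 (≐sym (∧E₁ #0)))))))))))))))))

rel-J-Seq* : ∀ φ → Seq* φ → Seq ⊢ rel J φ
rel-J-Seq* _ s1 = ∀I (⇒I (∀I (⇒I (⇒I (▹≉ε #0)))))
rel-J-Seq* _ s2 = ∀I (⇒I (∀I (⇒I (∀I (⇒I (∀I (⇒I (⇒I (▹-injective #0)))))))))
rel-J-Seq* _ s3 = ∀I (⇒I (∧I (∙-identityʳ v0) (∧E₁ (∧E₂ #0))))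
rel-J-Seq* _ s4 = ∀I (⇒I (∀I (⇒I (∀I (⇒I (∙-assoc-▹ v2 v1 v0))))))
rel-J-Seq* _ s5 = Seq₅*ᴶ

⪯-refl : Seq ⊢ PrecRefl J
⪯-refl = ∀I (∃I ε (∧I (closed InJ-ε) (≐sym (∙-identityʳ v0))))

⪯-trans : Seq ⊢ PrecTrans J
⪯-trans = ∀I (∀I (∀I (⇒I (∃E (∧E₁ #0) (∃E (∧E₂ #1)
  (∃I (v1 ∙ v0) (∧I (⇒E (⇒E (∀E v0 (∀E v1 (closed InJ-∙))) (∧E₁ #1)) (∧E₁ #0))
    (≐trans (∧E₂ #0) (≐trans (∙-congʳ v0 (∧E₂ #1)) (∀E v1 (∀E v4 (∧E₁ (∧E₁ #0)))))))))))))

⪯-downClosed : Seq ⊢ PrecDown J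
⪯-downClosed = ∀I (⇒I (∀I (⇒I (∃E #0
  (⇒E (⇒E (∀E v0 (∀E v1 (closed InJ-prefix))) (≐subst (InJ v0) (∧E₂ #0) #2)) (∧E₁ #0))))))

ε▹-∈J : Seq ⊢ ConsE J
ε▹-∈J = ∀I (⇒E (∀E v0 (∀E ε (closed InJ-▹))) (closed InJ-ε))

lemma5 : Σ Formula (λ J → Wf 1 J
    × (∀ φ → Seq* φ → Seq ⊢ rel J φ)
    × Seq ⊢ PrecRefl J
    × Seq ⊢ PrecTrans J
    × Seq ⊢ PrecDown J
    × Seq ⊢ ConsE J)
lemma5 = J , Wf-J , rel-J-Seq* , ⪯-refl , ⪯-trans , ⪯-downClosed , ε▹-∈J
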